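{- Let $n,t$ be integers with $1 < t \le n - 3$, let $F$ be a forest on vertex set $[n]$ with $t$ edges, and let $S$ be a spanning star of $K_n$ (a vertex joined to all other $n-1$ vertices) such that $F \not\subset S$. Then the number of spanning trees of $K_n$ that contain $F$ and have fewer than $t$ edges in common with $S$ is greater than $(n-1)^{n-2-t}$.
   Context: Graphs are regarded as sets of edges of the complete graph $K_n$ on $[n]$. -}

module Defs where

open import Data.Nat using (ℕ; _≤_)
open import Data.Fin using (Fin) renaming (_<_ to _<ᶠ_)
open import Data.Fin.Properties using (_<?_; _≟_)
open import Data.Fin.Base using ()
open import Data.List using (List; []; _∷_; _++_; [_]; length; concatMap; filterᵇ; allFin)
open import Data.List.Relation.Unary.Linked using (Linked)
open import Data.List.Relation.Unary.Unique.Propositional using (Unique)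
open import Data.Bool using (Bool; true; false; _∧_; _∨_)
open import Data.Product using (Σ; ∃; _×_)
open import Data.Sum using (_⊎_)
open import Relation.Binary.PropositionalEquality using (_≡_)
open import Relation.Binary.Construct.Closure.ReflexiveTransitive using (Star)
open import Relation.Nullary using (¬_; yes; no)
open import Relation.Nullary.Decidable using (⌊_⌋)

-- An edge of the complete graph K_n on vertex set Fin n ( = [n] ):
-- an unordered pair {lo, hi}, stored with lo < hi.
record Edge (n : ℕ) : Set where
  constructor edge
  field
    lo hi : Fin n
    lo<hi : lo <ᶠ hi

Graph : ℕ → Set
Graph n = Edge n → Bool

_⊆ᴳ_ : {n : ℕ} → Graph n → Graph n → Set
F ⊆ᴳ T = ∀ e → F e ≡ true → T e ≡ true

Differ : {n : ℕ} → Graph n → Graph n → Set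
Differ G H = ∃ λ e → ¬ (G e ≡ H e)

Adj : {n : ℕ} → Graph n → Fin n → Fin n → Set
Adj G u v = (Σ (u <ᶠ v) λ p → G (edge u v p) ≡ true) ⊎ (Σ (v <ᶠ u) λ p → G (edge v u p) ≡ true)

Connected : {n : ℕ} → Graph n → Set
Connected G = ∀ u v → Star (Adj G) u v

-- a cycle: distinct vertices v, w₁, …, wₖ, w (k ≥ 1, so length ≥ 3),
-- consecutive ones adjacent, and w adjacent to v
HasCycle : {n : ℕ} → Graph n → Set
HasCycle {n} G = ∃ λ (v : Fin n) → ∃ λ (w : Fin n) → ∃ λ (ws : List (Fin n)) →
  1 ≤ length ws × Unique (v ∷ ws ++ [ w ]) × Linked (Adj G) (v ∷ ws ++ [ w ]) × Adj G w v

IsForest : {n : ℕ} → Graph n → Set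
IsForest G = ¬ HasCycle G

IsSpanningTree : {n : ℕ} → Graph n → Set
IsSpanningTree T = Connected T × IsForest T

allEdges : (n : ℕ) → List (Edge n)
allEdges n = concatMap (λ i → concatMap (λ j → pick i j) (allFin n)) (allFin n)
  where
  pick : Fin n → Fin n → List (Edge n)
  pick i j with i <? j
  ... | yes p = edge i j p ∷ []
  ... | no _ = []

edgeCount : {n : ℕ} → Graph n → ℕ
edgeCount {n} G = length (filterᵇ G (allEdges n))

_∩ᴳ_ : {n : ℕ} → Graph n → Graph n → Graph n
(G ∩ᴳ H) e = G e ∧ H e

star : {n : ℕ} → Fin n → Graph n
star c (edge i j _) = ⌊ i ≟ c ⌋ ∨ ⌊ j ≟ c ⌋

{-# OPTIONS --safe #-}
-- Let uv be an edge of F that avoids the centre c, R the component of F containing it, and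
-- L₁, …, L_k the other components; every edge of F merges two of the n singletons, so
-- k ≥ n − t − 1 ≥ 2.  As in Prüfer's bijection, a word of length k whose last letter is u or v
-- decodes into a spanning tree containing F: repeatedly take the first component in which no
-- remaining letter lies, and join a fixed vertex of it to the current letter.  At the first step
-- where two words decode differently, either some component is a leaf of one tree (one edge
-- leaves it) but not of the other, or the same component is joined to different letters; so
-- distinct words give distinct trees, and there are 2 (n − 1)^(k − 1) > (n − 1)^(n − 2 − t)
-- words avoiding the letter c.  If c has an F-neighbour w, attaching the component of c through
-- w keeps c off every new edge, so T ∩ S ⊆ F ∩ S ⊊ F.  If c is isolated in F it never lies in a
-- remaining letter's component, so it is a leaf of T and T ∩ S is a single edge.

module Submission where

open import Defs
open import Data.Bool using (Bool; true; false; _∧_; _∨_; T; if_then_else_)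
import Data.Bool.Properties as Bool
open import Data.Empty using (⊥; ⊥-elim)
open import Data.Fin using (Fin) renaming (_<_ to _<ᶠ_)
open import Data.Fin.Properties using (_<?_; _≟_; <-cmp; <-irrelevant)
open import Data.List
  using (List; []; _∷_; _++_; _∷ʳ_; [_]; length; filter; filterᵇ; map; concatMap; foldl; allFin;
         cartesianProductWith)
open import Data.List.Properties
  using (filter-accept; filter-reject; filter-all; filter-notAll; ∷-injective; ∷ʳ-injective;
         length-++; length-map; length-tabulate)
open import Data.List.Membership.Propositional using (_∈_; _∉_; find; lose)
open import Data.List.Membership.Propositional.Properties
  using (∈-++⁺ˡ; ∈-++⁺ʳ; ∈-++⁻; ∈-filter⁺; ∈-filter⁻; ∈-map⁺; ∈-map⁻; ∈-concatMap⁺; ∈-concatMap⁻;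
         ∈-cartesianProductWith⁻; ∈-allFin)
open import Data.List.Relation.Unary.All as All using (All; []; _∷_)
import Data.List.Relation.Unary.All.Properties as All
open import Data.List.Relation.Unary.AllPairs as AllPairs using (AllPairs; []; _∷_)
import Data.List.Relation.Unary.AllPairs.Properties as AllPairs
open import Data.List.Relation.Unary.Any as Any using (Any; here; there)
open import Data.List.Relation.Unary.Linked as Linked using (Linked; [-]; _∷_)
open import Data.List.Relation.Unary.Unique.Propositional using (Unique)
open import Data.List.Relation.Unary.Unique.Propositional.Properties as Unique using (allFin⁺)
open import Data.Nat using (ℕ; zero; suc; _+_; _∸_; _*_; _^_; _≤_; _<_; z≤n; s≤s)
open import Data.Nat.Properties
  using (<-irrefl; <-asym; ≤-trans; ≤-reflexive; ≤-<-trans; m≤n⇒m≤1+n; m≤m+n; m≤n+m; +-comm; +-suc;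
         suc-injective; ∸-monoˡ-≤; m+n∸n≡m; ^-monoʳ-≤; m<m*n; m^n≢0; module ≤-Reasoning)
open import Data.Product using (Σ; ∃; ∃₂; _×_; _,_; proj₁; proj₂)
open import Data.Sum as Sum using (_⊎_; inj₁; inj₂; [_,_]′)
open import Data.Unit using (⊤; tt)
open import Function using (id; _∘_; Equivalence)
open import Relation.Binary.Construct.Closure.ReflexiveTransitive as Star using (Star; ε; _◅_; _◅◅_)
open import Relation.Binary.Definitions using (DecidableEquality; tri<; tri≈; tri>)
open import Relation.Binary.PropositionalEquality
  using (_≡_; _≢_; refl; sym; trans; cong; cong₂; subst; ≢-sym; module ≡-Reasoning)
open import Relation.Nullary using (¬_; ¬?; T?; contradiction; Dec; does; yes; no; _⊎-dec_; _×-dec_; map′)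
open import Relation.Nullary.Decidable using (dec-true)
open import Relation.Unary using (Decidable)

-- Walks and cycles

module _ {A : Set} where

  last : A → List A → A
  last a [] = a
  last a (b ∷ bs) = last b bs

  last-∷ʳ : ∀ a bs b → last a (bs ∷ʳ b) ≡ b
  last-∷ʳ a [] b = refl
  last-∷ʳ a (c ∷ bs) b = last-∷ʳ c bs b

  last-++ : ∀ a bs b cs → last a (bs ++ b ∷ cs) ≡ last b cs
  last-++ a [] b cs = refl
  last-++ a (c ∷ bs) b cs = last-++ c bs b cs

  last-∈ : ∀ a bs → last a bs ∈ a ∷ bs
  last-∈ a [] = here refl
  last-∈ a (b ∷ bs) = there (last-∈ b bs)

  linked⇒star : ∀ {R : A → A → Set} a bs → Linked R (a ∷ bs) → Star R a (last a bs)
  linked⇒star a [] _ = ε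
  linked⇒star a (b ∷ bs) (r ∷ rs) = r ◅ linked⇒star b bs rs

module _ {n : ℕ} where

  Walk : Graph n → Fin n → Fin n → Set
  Walk G = Star (Adj G)

  adj-sym : ∀ {G : Graph n} {u v} → Adj G u v → Adj G v u
  adj-sym (inj₁ a) = inj₂ a
  adj-sym (inj₂ a) = inj₁ a

  walk-sym : ∀ {G : Graph n} {u v} → Walk G u v → Walk G v u
  walk-sym {G} = Star.reverse (adj-sym {G})

  adj-mono : ∀ {G H : Graph n} → G ⊆ᴳ H → ∀ {u v} → Adj G u v → Adj H u v
  adj-mono G⊆H (inj₁ (p , e)) = inj₁ (p , G⊆H _ e)
  adj-mono G⊆H (inj₂ (p , e)) = inj₂ (p , G⊆H _ e)

  walk-mono : ∀ {G H : Graph n} → G ⊆ᴳ H → ∀ {u v} → Walk G u v → Walk H u v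
  walk-mono G⊆H = Star.map (adj-mono G⊆H)

  walk-invariant : ∀ {G : Graph n} {A : Set} {f : Fin n → A} → (∀ {u v} → Adj G u v → f u ≡ f v) →
    ∀ {u v} → Walk G u v → f u ≡ f v
  walk-invariant adj⇒≡ ε = refl
  walk-invariant adj⇒≡ (uv ◅ vw) = trans (adj⇒≡ uv) (walk-invariant adj⇒≡ vw)

  adj⇒≢ : ∀ {G : Graph n} {u v} → Adj G u v → u ≢ v
  adj⇒≢ (inj₁ (p , _)) refl = <-irrefl refl p
  adj⇒≢ (inj₂ (p , _)) refl = <-irrefl refl p

  forest-antimono : ∀ {G H : Graph n} → G ⊆ᴳ H → IsForest H → IsForest G
  forest-antimono G⊆H H-forest (v , w , ws , 1≤ , uniq , linked , closing) =
    H-forest (v , w , ws , 1≤ , uniq , Linked.map (adj-mono G⊆H) linked , adj-mono G⊆H closing)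

  adj? : (G : Graph n) → ∀ u v → Dec (Adj G u v)
  adj? G u v = oriented u v ⊎-dec oriented v u
    where
    oriented : ∀ a b → Dec (Σ (a <ᶠ b) λ p → G (edge a b p) ≡ true)
    oriented a b with a <? b
    ... | no a≮b = no (a≮b ∘ proj₁)
    ... | yes p = map′ (p ,_) (λ (q , e) → subst (λ q → G (edge a b q) ≡ true) (<-irrelevant q p) e)
                       (G (edge a b p) Bool.≟ true)

  Joins : Fin n × Fin n → Fin n → Fin n → Set
  Joins (x , y) a b = (a ≡ x × b ≡ y) ⊎ (a ≡ y × b ≡ x)

  joins-sym : ∀ {p a b} → Joins p a b → Joins p b a
  joins-sym (inj₁ (a≡x , b≡y)) = inj₂ (b≡y , a≡x)
  joins-sym (inj₂ (a≡y , b≡x)) = inj₁ (b≡x , a≡y)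

  joins-self : ∀ {a b} → Joins (a , b) a b
  joins-self = inj₁ (refl , refl)

  joins-trans : ∀ {p a b c d} → Joins p a b → Joins p c d → Joins (a , b) c d
  joins-trans (inj₁ (refl , refl)) (inj₁ (refl , refl)) = inj₁ (refl , refl)
  joins-trans (inj₁ (refl , refl)) (inj₂ (refl , refl)) = inj₂ (refl , refl)
  joins-trans (inj₂ (refl , refl)) (inj₁ (refl , refl)) = inj₂ (refl , refl)
  joins-trans (inj₂ (refl , refl)) (inj₂ (refl , refl)) = inj₁ (refl , refl)

  joins-end : ∀ {p a b} → Joins p a b → proj₁ p ≡ a ⊎ proj₁ p ≡ b
  joins-end (inj₁ (refl , _)) = inj₁ refl
  joins-end (inj₂ (_ , refl)) = inj₂ refl

  joins-∉ : ∀ {p a b x} → proj₁ p ≢ x → proj₂ p ≢ x → Joins p a b → a ≢ x × b ≢ x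
  joins-∉ p₁≢x p₂≢x (inj₁ (refl , refl)) = p₁≢x , p₂≢x
  joins-∉ p₁≢x p₂≢x (inj₂ (refl , refl)) = p₂≢x , p₁≢x

  joins-shared : ∀ {p a b c d} → Joins p a b → Joins p c d → a ≡ c ⊎ a ≡ d
  joins-shared j j′ = Sum.map (sym ∘ proj₁) (sym ∘ proj₂) (joins-trans j j′)

  joins? : ∀ p a b → Dec (Joins p a b)
  joins? (x , y) a b = ((a ≟ x) ×-dec (b ≟ y)) ⊎-dec ((a ≟ y) ×-dec (b ≟ x))

module AddEdge {n : ℕ} {G H : Graph n} {x y : Fin n}
  (G⊆H+xy : ∀ {a b} → Adj G a b → Adj H a b ⊎ Joins (x , y) a b)
  (x↮y : ¬ Walk H x y) (H-forest : IsForest H) where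

  no-walk : ∀ {a b} → Joins (x , y) a b → ¬ Walk H a b
  no-walk (inj₁ (refl , refl)) = x↮y
  no-walk (inj₂ (refl , refl)) = x↮y ∘ walk-sym

  Crossing : Fin n → List (Fin n) → Set
  Crossing a P = ∃₂ λ A b → ∃ λ B → P ≡ A ++ b ∷ B ×
    Linked (Adj H) (a ∷ A) × Linked (Adj H) (b ∷ B) × Joins (x , y) (last a A) b

  -- A path through distinct vertices uses the new edge at most once.
  split : ∀ a P → Unique (a ∷ P) → Linked (Adj G) (a ∷ P) → Linked (Adj H) (a ∷ P) ⊎ Crossing a P
  split a [] _ _ = inj₁ [-]
  split a (b ∷ P) (a∉ ∷ uniq) (ab ∷ linked) with split b P uniq linked | G⊆H+xy ab
  ... | inj₁ pathH | inj₁ abH = inj₁ (abH ∷ pathH)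
  ... | inj₁ pathH | inj₂ j = inj₂ ([] , b , P , refl , [-] , pathH , j)
  ... | inj₂ (A , c , B , eq , before , after , j) | inj₁ abH =
        inj₂ (b ∷ A , c , B , cong (b ∷_) eq , abH ∷ before , after , j)
  ... | inj₂ (A , c , B , refl , _ , _ , j′) | inj₂ j with joins-shared j j′
  ...   | inj₁ refl = ⊥-elim (All.lookup a∉ (∈-++⁺ˡ {xs = b ∷ A} (last-∈ b A)) refl)
  ...   | inj₂ refl = ⊥-elim (All.lookup a∉ (there (∈-++⁺ʳ A (here refl))) refl)

  crossing-twice : ∀ {v w q} ws A {b B} → Unique (v ∷ q ∷ ws ++ [ w ]) → q ∷ ws ++ [ w ] ≡ A ++ b ∷ B →
    Joins (x , y) (last v A) b → Joins (x , y) w v → ⊥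
  crossing-twice {q = q} ws [] (v∉ ∷ q∉ ∷ _) refl j j′ with joins-shared j′ j
  ... | inj₁ refl = All.lookup v∉ (∈-++⁺ʳ (q ∷ ws) (here refl)) refl
  ... | inj₂ refl = All.lookup q∉ (∈-++⁺ʳ ws (here refl)) refl
  crossing-twice ws (a ∷ A) {b} (v∉ ∷ _) eq j j′ with joins-shared (joins-sym j′) (joins-sym j)
  ... | inj₁ v≡b = All.lookup v∉ (subst (b ∈_) (sym eq) (∈-++⁺ʳ (a ∷ A) (here refl))) v≡b
  ... | inj₂ v≡last = All.lookup v∉ (subst (last a A ∈_) (sym eq) (∈-++⁺ˡ (last-∈ a A))) v≡last

  isForest : IsForest G
  isForest (v , w , [] , () , _)
  isForest (v , w , q ∷ ws , 1≤ , uniq , linked , closing)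
    with split v (q ∷ ws ++ [ w ]) uniq linked | G⊆H+xy closing
  ... | inj₁ pathH | inj₁ closeH = H-forest (v , w , q ∷ ws , 1≤ , uniq , pathH , closeH)
  ... | inj₁ pathH | inj₂ j =
        no-walk (joins-sym j) (subst (Walk H v) (last-∷ʳ v (q ∷ ws) w) (linked⇒star v _ pathH))
  ... | inj₂ (A , b , B , eq , before , after , j) | inj₁ closeH =
        no-walk (joins-sym j)
          (linked⇒star b B after ◅◅ subst (λ z → Adj H z v) w≡ closeH ◅ linked⇒star v A before)
    where
    w≡ : w ≡ last b B
    w≡ = trans (sym (last-∷ʳ v (q ∷ ws) w)) (trans (cong (last v) eq) (last-++ v A b B))
  ... | inj₂ (A , b , B , eq , _ , _ , j) | inj₂ j′ = crossing-twice ws A uniq eq j j′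

-- Counting and searching in lists

module _ {A : Set} {P Q : A → Set} (P? : Decidable P) (Q? : Decidable Q) where

  length-filter-mono : ∀ {xs} → All (λ x → P x → Q x) xs → length (filter P? xs) ≤ length (filter Q? xs)
  length-filter-mono [] = z≤n
  length-filter-mono {x ∷ xs} (P⇒Q ∷ rest) with P? x | Q? x
  ... | yes _ | yes _ = s≤s (length-filter-mono rest)
  ... | yes px | no ¬qx = contradiction (P⇒Q px) ¬qx
  ... | no _ | yes _ = m≤n⇒m≤1+n (length-filter-mono rest)
  ... | no _ | no _ = length-filter-mono rest

  length-filter-< : ∀ {xs} → All (λ x → P x → Q x) xs → ∀ {z} → z ∈ xs → ¬ P z → Q z →
    length (filter P? xs) < length (filter Q? xs)
  length-filter-< {x ∷ xs} (_ ∷ rest) (here refl) ¬pz qz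
    rewrite filter-reject P? {xs = xs} ¬pz | filter-accept Q? {xs = xs} qz = s≤s (length-filter-mono rest)
  length-filter-< {x ∷ xs} (P⇒Q ∷ rest) (there z∈) ¬pz qz with P? x | Q? x
  ... | yes _ | yes _ = s≤s (length-filter-< rest z∈ ¬pz qz)
  ... | yes px | no ¬qx = contradiction (P⇒Q px) ¬qx
  ... | no _ | yes _ = m≤n⇒m≤1+n (length-filter-< rest z∈ ¬pz qz)
  ... | no _ | no _ = length-filter-< rest z∈ ¬pz qz

  length-filter-mono-except : ∀ {w} → (∀ {x} → x ≢ w → P x → Q x) →
    ∀ {xs} → Unique xs → length (filter P? xs) ≤ suc (length (filter Q? xs))
  length-filter-mono-except P⇒Q {[]} _ = z≤n
  length-filter-mono-except {w} P⇒Q {x ∷ xs} (x∉ ∷ uniq) with P? x | Q? x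
  ... | yes _ | yes _ = s≤s (length-filter-mono-except P⇒Q uniq)
  ... | no _ | yes _ = m≤n⇒m≤1+n (length-filter-mono-except P⇒Q uniq)
  ... | no _ | no _ = length-filter-mono-except P⇒Q uniq
  ... | yes px | no ¬qx = s≤s (length-filter-mono (All.map (λ x≢y → P⇒Q (≢w x≢y)) x∉))
    where
    ≢w : ∀ {y} → x ≢ y → y ≢ w
    ≢w x≢y y≡w = ¬qx (P⇒Q (λ x≡w → x≢y (trans x≡w (sym y≡w))) px)

length≤1 : ∀ {A : Set} {xs : List A} → Unique xs → (∀ {a b} → a ∈ xs → b ∈ xs → a ≡ b) → length xs ≤ 1
length≤1 {xs = []} _ _ = z≤n
length≤1 {xs = _ ∷ []} _ _ = s≤s z≤n
length≤1 {xs = _ ∷ _ ∷ _} ((x≢y ∷ _) ∷ _) all≡ = contradiction (all≡ (here refl) (there (here refl))) x≢y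

++-∷-mismatch : ∀ {A : Set} {x x′ : A} pre {post} pre′ {post′} → pre ++ x ∷ post ≡ pre′ ++ x′ ∷ post′ →
  x ≢ x′ → x ∈ pre′ ⊎ x′ ∈ pre
++-∷-mismatch [] [] refl x≢x′ = contradiction refl x≢x′
++-∷-mismatch [] (_ ∷ _) refl _ = inj₁ (here refl)
++-∷-mismatch (_ ∷ _) [] refl _ = inj₂ (here refl)
++-∷-mismatch (_ ∷ pre) (_ ∷ pre′) eq x≢x′ with ++-∷-mismatch pre pre′ (proj₂ (∷-injective eq)) x≢x′
... | inj₁ x∈ = inj₁ (there x∈)
... | inj₂ x′∈ = inj₂ (there x′∈)

concatMap-unique : ∀ {A B : Set} {f : A → List B} {xs} → Unique xs → (∀ x → Unique (f x)) →
  (∀ {x y b} → b ∈ f x → b ∈ f y → x ≡ y) → Unique (concatMap f xs)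
concatMap-unique {f = f} {xs} uniq f-unique f-disjoint = Unique.concat⁺
  (All.map⁺ (All.tabulate (λ {x} _ → f-unique x)))
  (AllPairs.map⁺ (AllPairs.map (λ x≢y {_} (b∈fx , b∈fy) → x≢y (f-disjoint b∈fx b∈fy)) uniq))

allPairs-map : ∀ {A B : Set} {R : B → B → Set} {f : A → B} {xs} → Unique xs →
  (∀ {x y} → x ∈ xs → y ∈ xs → x ≢ y → R (f x) (f y)) → AllPairs R (map f xs)
allPairs-map {xs = []} [] _ = []
allPairs-map {xs = x ∷ xs} (x∉ ∷ uniq) Rf =
  All.map⁺ (All.tabulate (λ y∈ → Rf (here refl) (there y∈) (All.lookup x∉ y∈)))
  ∷ allPairs-map uniq (λ x∈ y∈ → Rf (there x∈) (there y∈))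

module DecLists {A : Set} (_≟ᴬ_ : DecidableEquality A) where

  open import Data.List.Membership.DecPropositional _≟ᴬ_ using (_∈?_)

  remove : A → List A → List A
  remove x = filter (λ y → ¬? (y ≟ᴬ x))

  ∈-remove⁺ : ∀ {x y xs} → y ∈ xs → y ≢ x → y ∈ remove x xs
  ∈-remove⁺ {x} = ∈-filter⁺ (λ y → ¬? (y ≟ᴬ x))

  ∈-remove⁻ : ∀ {x y} xs → y ∈ remove x xs → y ∈ xs × y ≢ x
  ∈-remove⁻ {x} xs = ∈-filter⁻ (λ y → ¬? (y ≟ᴬ x)) {xs = xs}

  remove-unique : ∀ {x xs} → Unique xs → Unique (remove x xs)
  remove-unique {x} = Unique.filter⁺ (λ y → ¬? (y ≟ᴬ x))

  length-remove : ∀ {x xs} → Unique xs → x ∈ xs → suc (length (remove x xs)) ≡ length xs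
  length-remove {x} {_ ∷ xs} (x∉ ∷ _) (here refl)
    rewrite filter-reject (λ y → ¬? (y ≟ᴬ x)) {xs = xs} (λ x≢x → x≢x refl)
          | filter-all (λ y → ¬? (y ≟ᴬ x)) (All.map ≢-sym x∉) = refl
  length-remove {x} {y ∷ xs} (y∉ ∷ uniq) (there x∈)
    rewrite filter-accept (λ y → ¬? (y ≟ᴬ x)) {xs = xs} (λ y≡x → All.lookup y∉ x∈ y≡x)
    = cong suc (length-remove uniq x∈)

  pigeonhole : ∀ {xs ys} → Unique xs → All (_∈ ys) xs → length xs ≤ length ys
  pigeonhole {[]} _ _ = z≤n
  pigeonhole {x ∷ xs} {ys} (x∉ ∷ uniq) (x∈ys ∷ xs⊆ys) = ≤-trans
    (s≤s (pigeonhole uniq (All.zipWith (λ (y∈ , x≢y) → ∈-remove⁺ y∈ (≢-sym x≢y)) (xs⊆ys , x∉))))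
    (filter-notAll (λ y → ¬? (y ≟ᴬ x)) ys (Any.map (λ { refl x≢x → x≢x refl }) x∈ys))

  FirstMissing : A → List A → List A → Set
  FirstMissing x xs ys = ∃₂ λ pre post → xs ≡ pre ++ x ∷ post × All (_∈ ys) pre × x ∉ ys

  firstMissing? : ∀ xs ys → (∃ λ x → FirstMissing x xs ys) ⊎ All (_∈ ys) xs
  firstMissing? [] ys = inj₂ []
  firstMissing? (x ∷ xs) ys with x ∈? ys
  ... | no x∉ = inj₁ (x , [] , xs , refl , [] , x∉)
  ... | yes x∈ with firstMissing? xs ys
  ...   | inj₁ (z , pre , post , refl , pre⊆ , z∉) = inj₁ (z , x ∷ pre , post , refl , x∈ ∷ pre⊆ , z∉)
  ...   | inj₂ xs⊆ = inj₂ (x∈ ∷ xs⊆)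

  firstMissing-∈ : ∀ {x xs ys} → FirstMissing x xs ys → x ∈ xs
  firstMissing-∈ (pre , _ , refl , _ , _) = ∈-++⁺ʳ pre (here refl)

  firstMissing-∉ : ∀ {x xs ys} → FirstMissing x xs ys → x ∉ ys
  firstMissing-∉ (_ , _ , _ , _ , x∉) = x∉

  firstMissing-≢ : ∀ {x x′ xs ys ys′} → FirstMissing x xs ys → FirstMissing x′ xs ys′ → x ≢ x′ →
    x ∈ ys′ ⊎ x′ ∈ ys
  firstMissing-≢ (pre , _ , refl , pre⊆ , _) (pre′ , _ , eq , pre′⊆ , _) x≢x′
    with ++-∷-mismatch pre pre′ eq x≢x′
  ... | inj₁ x∈pre′ = inj₁ (All.lookup pre′⊆ x∈pre′)
  ... | inj₂ x′∈pre = inj₂ (All.lookup pre⊆ x′∈pre)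

module _ {A : Set} where

  length-cartesianProductWith : ∀ {B C : Set} (f : A → B → C) xs ys →
    length (cartesianProductWith f xs ys) ≡ length xs * length ys
  length-cartesianProductWith f [] ys = refl
  length-cartesianProductWith f (x ∷ xs) ys = begin
    length (map (f x) ys ++ cartesianProductWith f xs ys)  ≡⟨ length-++ (map (f x) ys) ⟩
    length (map (f x) ys) + length (cartesianProductWith f xs ys)
      ≡⟨ cong₂ _+_ (length-map (f x) ys) (length-cartesianProductWith f xs ys) ⟩
    length ys + length xs * length ys  ∎
    where open ≡-Reasoning

  words : List A → ℕ → List (List A)
  words as zero = [ [] ]
  words as (suc m) = cartesianProductWith _∷_ as (words as m)

  length-words : ∀ as m → length (words as m) ≡ length as ^ m
  length-words as zero = refl
  length-words as (suc m) =
    trans (length-cartesianProductWith _∷_ as (words as m)) (cong (length as *_) (length-words as m))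

  words-unique : ∀ {as} m → Unique as → Unique (words as m)
  words-unique zero _ = [] ∷ []
  words-unique (suc m) uniq = Unique.cartesianProductWith⁺ _∷_ ∷-injective uniq (words-unique m uniq)

  ∈-words⁻ : ∀ {as} m {w} → w ∈ words as m → length w ≡ m × All (_∈ as) w
  ∈-words⁻ zero (here refl) = refl , []
  ∈-words⁻ {as} (suc m) w∈ with ∈-cartesianProductWith⁻ _∷_ as (words as m) w∈
  ... | a , w , a∈ , w∈′ , refl = cong suc (proj₁ (∈-words⁻ m w∈′)) , a∈ ∷ proj₂ (∈-words⁻ m w∈′)

-- The edges of K_n

-- allEdges is assembled from a cell function that is local to Defs; this gives it a name.
allEdges-cells : ∀ n → ∃ λ (cell : Fin n → Fin n → List (Edge n)) →
  allEdges n ≡ concatMap (λ i → concatMap (cell i) (allFin n)) (allFin n)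
allEdges-cells n = _ , refl

module _ {n : ℕ} where

  private
    cell : Fin n → Fin n → List (Edge n)
    cell = proj₁ (allEdges-cells n)

    row : Fin n → List (Edge n)
    row i = concatMap (cell i) (allFin n)

  edge∈cell : ∀ i j (p : i <ᶠ j) → edge i j p ∈ cell i j
  edge∈cell i j p with i <? j
  ... | yes q = here (cong (edge i j) (<-irrelevant p q))
  ... | no i≮j = contradiction p i≮j

  cell-ends : ∀ i j {e} → e ∈ cell i j → Edge.lo e ≡ i × Edge.hi e ≡ j
  cell-ends i j e∈ with i <? j
  cell-ends i j (here refl) | yes _ = refl , refl

  cell-unique : ∀ i j → Unique (cell i j)
  cell-unique i j with i <? j
  ... | yes _ = [] ∷ []
  ... | no _ = []

  row-lo : ∀ i {e} → e ∈ row i → Edge.lo e ≡ i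
  row-lo i e∈ =
    let (j , _ , e∈′) = find (∈-concatMap⁻ (cell i) {xs = allFin n} e∈) in proj₁ (cell-ends i j e∈′)

  ∈-allEdges : ∀ e → e ∈ allEdges n
  ∈-allEdges (edge i j p) =
    ∈-concatMap⁺ _ (lose (∈-allFin i) (∈-concatMap⁺ (cell i) (lose (∈-allFin j) (edge∈cell i j p))))

  allEdges-unique : Unique (allEdges n)
  allEdges-unique = concatMap-unique (allFin⁺ n)
    (λ i → concatMap-unique (allFin⁺ n) (cell-unique i)
      (λ e∈ e∈′ → trans (sym (proj₂ (cell-ends _ _ e∈))) (proj₂ (cell-ends _ _ e∈′))))
    (λ e∈ e∈′ → trans (sym (row-lo _ e∈)) (row-lo _ e∈′))

  joins-edge-≡ : ∀ {p} {e e′ : Edge n} →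
    Joins p (Edge.lo e) (Edge.hi e) → Joins p (Edge.lo e′) (Edge.hi e′) → e ≡ e′
  joins-edge-≡ {e = edge _ _ p} {edge _ _ q} (inj₁ (refl , refl)) (inj₁ (refl , refl)) =
    cong (edge _ _) (<-irrelevant p q)
  joins-edge-≡ {e = edge _ _ p} {edge _ _ q} (inj₂ (refl , refl)) (inj₂ (refl , refl)) =
    cong (edge _ _) (<-irrelevant p q)
  joins-edge-≡ {e = edge _ _ p} {edge _ _ q} (inj₁ (refl , refl)) (inj₂ (refl , refl)) = contradiction q (<-asym p)
  joins-edge-≡ {e = edge _ _ p} {edge _ _ q} (inj₂ (refl , refl)) (inj₁ (refl , refl)) = contradiction q (<-asym p)

  private
    T⇒≡ : ∀ {b} → T b → b ≡ true
    T⇒≡ = Equivalence.to Bool.T-≡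

    ≡⇒T : ∀ {b} → b ≡ true → T b
    ≡⇒T = Equivalence.from Bool.T-≡

    ⊆ᴳ⇒T : ∀ {G H : Graph n} → G ⊆ᴳ H → ∀ {e} → T (G e) → T (H e)
    ⊆ᴳ⇒T G⊆H t = ≡⇒T (G⊆H _ (T⇒≡ t))

  edgesOf : Graph n → List (Edge n)
  edgesOf G = filterᵇ G (allEdges n)

  ∈-edgesOf⁺ : ∀ {G : Graph n} {e} → G e ≡ true → e ∈ edgesOf G
  ∈-edgesOf⁺ {G} {e} Ge = ∈-filter⁺ (T? ∘ G) (∈-allEdges e) (≡⇒T Ge)

  ∈-edgesOf⁻ : ∀ {G : Graph n} {e} → e ∈ edgesOf G → G e ≡ true
  ∈-edgesOf⁻ {G} e∈ = T⇒≡ (proj₂ (∈-filter⁻ (T? ∘ G) {xs = allEdges n} e∈))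

  edgeCount-mono : ∀ {G H : Graph n} → G ⊆ᴳ H → edgeCount G ≤ edgeCount H
  edgeCount-mono {G} {H} G⊆H =
    length-filter-mono (T? ∘ G) (T? ∘ H) {allEdges n} (All.tabulate (λ _ → ⊆ᴳ⇒T G⊆H))

  edgeCount-< : ∀ {G H : Graph n} → G ⊆ᴳ H → ∀ e → G e ≡ false → H e ≡ true → edgeCount G < edgeCount H
  edgeCount-< {G} {H} G⊆H e ¬Ge He = length-filter-< (T? ∘ G) (T? ∘ H)
    (All.tabulate (λ _ → ⊆ᴳ⇒T G⊆H)) (∈-allEdges e) (subst T ¬Ge) (≡⇒T He)

  edgeCount≤1 : ∀ {G : Graph n} p → (∀ e → G e ≡ true → Joins p (Edge.lo e) (Edge.hi e)) → edgeCount G ≤ 1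
  edgeCount≤1 {G} p G⊆p = length≤1 (Unique.filter⁺ (T? ∘ G) allEdges-unique)
    (λ e∈ e′∈ → joins-edge-≡ (G⊆p _ (∈-edgesOf⁻ e∈)) (G⊆p _ (∈-edgesOf⁻ e′∈)))

-- Graphs with added edges

module _ {n : ℕ} where

  infixl 6 _+ᴾ_
  _+ᴾ_ : Graph n → List (Fin n × Fin n) → Graph n
  (G +ᴾ ps) (edge a b p) = G (edge a b p) ∨ does (Any.any? (λ q → joins? q a b) ps)

  ⊆-+ᴾ : ∀ {G : Graph n} ps → G ⊆ᴳ (G +ᴾ ps)
  ⊆-+ᴾ ps (edge a b p) Ge rewrite Ge = refl

  +ᴾ-[] : ∀ {G : Graph n} → (G +ᴾ []) ⊆ᴳ G
  +ᴾ-[] {G} e in-G+[] = trans (sym (Bool.∨-identityʳ (G e))) in-G+[]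

  private
    does⇒ : ∀ {P : Set} (P? : Dec P) → does P? ≡ true → P
    does⇒ (yes p) _ = p

    ∈-+ᴾ : ∀ {G : Graph n} {ps a b} (p : a <ᶠ b) → Any (λ q → Joins q a b) ps → (G +ᴾ ps) (edge a b p) ≡ true
    ∈-+ᴾ {G} {ps} {a} {b} p found rewrite dec-true (Any.any? (λ q → joins? q a b) ps) found =
      Bool.∨-zeroʳ (G (edge a b p))

  edge-+ᴾ⁻ : ∀ {G : Graph n} ps e → (G +ᴾ ps) e ≡ true →
    G e ≡ true ⊎ ∃ λ q → q ∈ ps × Joins q (Edge.lo e) (Edge.hi e)
  edge-+ᴾ⁻ {G} ps (edge a b p) in-G+ps with G (edge a b p)
  ... | true = inj₁ refl
  ... | false = inj₂ (find (does⇒ (Any.any? (λ q → joins? q a b) ps) in-G+ps))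

  adj-+ᴾ⁻ : ∀ {G : Graph n} ps {a b} → Adj (G +ᴾ ps) a b → Adj G a b ⊎ ∃ λ q → q ∈ ps × Joins q a b
  adj-+ᴾ⁻ {G} ps (inj₁ (p , in-G+ps)) with edge-+ᴾ⁻ {G} ps _ in-G+ps
  ... | inj₁ Ge = inj₁ (inj₁ (p , Ge))
  ... | inj₂ found = inj₂ found
  adj-+ᴾ⁻ {G} ps (inj₂ (p , in-G+ps)) with edge-+ᴾ⁻ {G} ps _ in-G+ps
  ... | inj₁ Ge = inj₁ (inj₂ (p , Ge))
  ... | inj₂ (q , q∈ , j) = inj₂ (q , q∈ , joins-sym j)

  adj-+ᴾ⁺ : ∀ {G : Graph n} ps {q a b} → q ∈ ps → Joins q a b → a ≢ b → Adj (G +ᴾ ps) a b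
  adj-+ᴾ⁺ {G} ps {a = a} {b} q∈ j a≢b with <-cmp a b
  ... | tri< a<b _ _ = inj₁ (a<b , ∈-+ᴾ {G} a<b (lose q∈ j))
  ... | tri≈ _ a≡b _ = contradiction a≡b a≢b
  ... | tri> _ _ b<a = inj₂ (b<a , ∈-+ᴾ {G} b<a (lose q∈ (joins-sym j)))

  adj-+ᴾ-∷⁻ : ∀ {G : Graph n} q ps {a b} → Adj (G +ᴾ (q ∷ ps)) a b → Adj (G +ᴾ ps) a b ⊎ Joins q a b
  adj-+ᴾ-∷⁻ {G} q ps adj with adj-+ᴾ⁻ {G} (q ∷ ps) adj
  ... | inj₁ adjG = inj₁ (adj-mono {G = G} {H = G +ᴾ ps} (⊆-+ᴾ ps) adjG)
  ... | inj₂ (_ , here refl , j) = inj₂ j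
  ... | inj₂ (_ , there q′∈ , j) = inj₁ (adj-+ᴾ⁺ {G} ps q′∈ j (adj⇒≢ {G = G +ᴾ (q ∷ ps)} adj))

  ∩ᴳ⁻ : ∀ {G H : Graph n} {e} → (G ∩ᴳ H) e ≡ true → G e ≡ true × H e ≡ true
  ∩ᴳ⁻ {G} {H} {e} in-both with G e | H e
  ... | true | true = refl , refl

  differ-adj : ∀ {G H : Graph n} {a b} → Adj G a b → ¬ Adj H a b → Differ G H
  differ-adj (inj₁ (p , Ge)) ¬adj = edge _ _ p , λ G≡H → ¬adj (inj₁ (p , trans (sym G≡H) Ge))
  differ-adj (inj₂ (p , Ge)) ¬adj = edge _ _ p , λ G≡H → ¬adj (inj₂ (p , trans (sym G≡H) Ge))

  differ-sym : ∀ {G H : Graph n} → Differ G H → Differ H G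
  differ-sym (e , G≢H) = e , G≢H ∘ sym

-- Components by union–find

roots : ∀ {n} → (Fin n → Fin n) → List (Fin n)
roots {n} lab = filter (λ x → lab x ≟ x) (allFin n)

module _ {n : ℕ} (lab : Fin n → Fin n) where

  ∈-roots⁺ : ∀ {x} → lab x ≡ x → x ∈ roots lab
  ∈-roots⁺ {x} = ∈-filter⁺ (λ x → lab x ≟ x) (∈-allFin x)

  ∈-roots⁻ : ∀ {x} → x ∈ roots lab → lab x ≡ x
  ∈-roots⁻ x∈ = proj₂ (∈-filter⁻ (λ x → lab x ≟ x) {xs = allFin n} x∈)

  roots-unique : Unique (roots lab)
  roots-unique = Unique.filter⁺ (λ x → lab x ≟ x) (allFin⁺ n)

record Components {n : ℕ} (F : Graph n) : Set where
  field
    lab : Fin n → Fin n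
    lab-idem : ∀ x → lab (lab x) ≡ lab x
    walk-lab : ∀ x → Walk F x (lab x)
    adj-lab : ∀ {a b} → Adj F a b → lab a ≡ lab b
    n≤roots+edges : n ≤ length (roots lab) + edgeCount F

  walk⇒lab : ∀ {a b} → Walk F a b → lab a ≡ lab b
  walk⇒lab = walk-invariant adj-lab

  lab⇒walk : ∀ {a b} → lab a ≡ lab b → Walk F a b
  lab⇒walk {a} {b} la≡lb = walk-lab a ◅◅ subst (λ z → Walk F z b) (sym la≡lb) (walk-sym (walk-lab b))

module UnionFind {n : ℕ} (F : Graph n) where

  record Sound (lab : Fin n → Fin n) : Set where
    field
      idem : ∀ x → lab (lab x) ≡ lab x
      walk : ∀ x → Walk F x (lab x)

  open Sound

  merge : (Fin n → Fin n) → Edge n → Fin n → Fin n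
  merge lab e x = if does (lab x ≟ lab (Edge.hi e)) then lab (Edge.lo e) else lab x

  merge-sound : ∀ {lab} e → F e ≡ true → Sound lab → Sound (merge lab e)
  merge-sound {lab} e@(edge a b p) Fe s = record { idem = idem′ ; walk = walk′ }
    where
    idem′ : ∀ x → merge lab e (merge lab e x) ≡ merge lab e x
    idem′ x with lab x ≟ lab b
    ... | yes _ rewrite idem s a with lab a ≟ lab b
    ...   | yes _ = refl
    ...   | no _ = refl
    idem′ x | no lx≢lb rewrite idem s x with lab x ≟ lab b
    ...   | yes lx≡lb = contradiction lx≡lb lx≢lb
    ...   | no _ = refl
    walk′ : ∀ x → Walk F x (merge lab e x)
    walk′ x with lab x ≟ lab b
    ... | yes lx≡lb =
      walk s x ◅◅ subst (λ z → Walk F z b) (sym lx≡lb) (walk-sym (walk s b)) ◅◅ inj₂ (p , Fe) ◅ walk s a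
    ... | no _ = walk s x

  merge-resp : ∀ lab e {a b} → lab a ≡ lab b → merge lab e a ≡ merge lab e b
  merge-resp lab e la≡lb rewrite la≡lb = refl

  merge-joins : ∀ lab e → merge lab e (Edge.lo e) ≡ merge lab e (Edge.hi e)
  merge-joins lab (edge a b _) with lab b ≟ lab b | lab a ≟ lab b
  ... | yes _ | yes _ = refl
  ... | yes _ | no _ = refl
  ... | no lb≢lb | _ = contradiction refl lb≢lb

  merge-roots : ∀ lab e → length (roots lab) ≤ suc (length (roots (merge lab e)))
  merge-roots lab e =
    length-filter-mono-except (λ x → lab x ≟ x) (λ x → merge lab e x ≟ x) still-root (allFin⁺ n)
    where
    still-root : ∀ {x} → x ≢ lab (Edge.hi e) → lab x ≡ x → merge lab e x ≡ x
    still-root {x} x≢lb lx≡x with lab x ≟ lab (Edge.hi e)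
    ... | yes lx≡lb = contradiction (trans (sym lx≡x) lx≡lb) x≢lb
    ... | no _ = lx≡x

  unionFind : (Fin n → Fin n) → List (Edge n) → Fin n → Fin n
  unionFind = foldl merge

  unionFind-sound : ∀ {lab} es → All (λ e → F e ≡ true) es → Sound lab → Sound (unionFind lab es)
  unionFind-sound [] [] s = s
  unionFind-sound (e ∷ es) (Fe ∷ Fes) s = unionFind-sound es Fes (merge-sound e Fe s)

  unionFind-resp : ∀ lab es {a b} → lab a ≡ lab b → unionFind lab es a ≡ unionFind lab es b
  unionFind-resp lab [] la≡lb = la≡lb
  unionFind-resp lab (e ∷ es) la≡lb = unionFind-resp (merge lab e) es (merge-resp lab e la≡lb)

  unionFind-joins : ∀ lab {es e} → e ∈ es → unionFind lab es (Edge.lo e) ≡ unionFind lab es (Edge.hi e)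
  unionFind-joins lab {e ∷ es} (here refl) = unionFind-resp (merge lab e) es (merge-joins lab e)
  unionFind-joins lab {e′ ∷ es} (there e∈) = unionFind-joins (merge lab e′) e∈

  unionFind-roots : ∀ lab es → length (roots lab) ≤ length (roots (unionFind lab es)) + length es
  unionFind-roots lab [] = m≤m+n _ 0
  unionFind-roots lab (e ∷ es) = begin
    length (roots lab)                                    ≤⟨ merge-roots lab e ⟩
    suc (length (roots (merge lab e)))                    ≤⟨ s≤s (unionFind-roots (merge lab e) es) ⟩
    suc (length (roots (unionFind lab (e ∷ es))) + length es) ≡⟨ sym (+-suc _ _) ⟩
    length (roots (unionFind lab (e ∷ es))) + length (e ∷ es) ∎
    where open ≤-Reasoning

  roots-id : length (roots {n} id) ≡ n
  roots-id =
    trans (cong length (filter-all (λ x → x ≟ x) (All.universal (λ _ → refl) (allFin n)))) (length-tabulate id)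

components : ∀ {n} (F : Graph n) → Components F
components {n} F = record
  { lab = lab
  ; lab-idem = Sound.idem sound
  ; walk-lab = Sound.walk sound
  ; adj-lab = adj-lab
  ; n≤roots+edges = subst (_≤ length (roots lab) + edgeCount F) roots-id (unionFind-roots id (edgesOf F))
  }
  where
  open UnionFind F
  lab = unionFind id (edgesOf F)
  sound = unionFind-sound (edgesOf F) (All.tabulate ∈-edgesOf⁻)
    (record { idem = λ _ → refl ; walk = λ _ → ε })
  adj-lab : ∀ {a b} → Adj F a b → lab a ≡ lab b
  adj-lab (inj₁ (_ , Fe)) = unionFind-joins id (∈-edgesOf⁺ Fe)
  adj-lab (inj₂ (_ , Fe)) = sym (unionFind-joins id (∈-edgesOf⁺ Fe))

-- Prüfer-type decoding relative to a forest

module Decoding {n : ℕ} {F : Graph n} (C : Components F) (R : Fin n) (att : Fin n → Fin n)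
  (lab-att : ∀ L → Components.lab C L ≡ L → Components.lab C (att L) ≡ L) where

  open Components C
  open DecLists (_≟_ {n})

  labels : List (Fin n) → List (Fin n)
  labels = map lab

  -- fs holds the roots of the components still to be attached and acc the pairs produced so far;
  -- a step hangs the first of them containing no remaining letter, through att L, onto the letter s.
  -- The fallback branch is unreachable on valid codes (some-missing).
  decode : List (Fin n) → List (Fin n) → List (Fin n × Fin n) → List (Fin n × Fin n)
  decode fs [] acc = acc
  decode fs (s ∷ r) acc with firstMissing? fs (labels (s ∷ r))
  ... | inj₁ (L , _) = decode (remove L fs) r ((att L , s) ∷ acc)
  ... | inj₂ _ = acc

  Unattached : List (Fin n) → Fin n → Set
  Unattached fs x = lab x ∈ fs ⊎ lab x ≡ R

  EndsInR : List (Fin n) → Set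
  EndsInR [] = ⊤
  EndsInR (s ∷ r) = lab (last s r) ≡ R

  record Valid (fs code : List (Fin n)) : Set where
    field
      fs-unique : Unique fs
      fs-roots : All (λ L → lab L ≡ L) fs
      R∉fs : R ∉ fs
      length≡ : length fs ≡ length code
      code-unattached : All (Unattached fs) code
      ends-in-R : EndsInR code

  open Valid

  some-missing : ∀ {fs s r} → Valid fs (s ∷ r) → ¬ All (_∈ labels (s ∷ r)) fs
  some-missing {fs} {s} {r} v fs⊆ = <-irrefl (length≡ v) (begin-strict
    length fs                 <⟨ pigeonhole (R∉ ∷ fs-unique v) (R∈ ∷ fs⊆) ⟩
    length (labels (s ∷ r))   ≡⟨ length-map lab (s ∷ r) ⟩
    length (s ∷ r)            ∎)
    where
    open ≤-Reasoning
    R∉ : All (R ≢_) fs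
    R∉ = All.tabulate (λ L∈ R≡L → R∉fs v (subst (_∈ fs) (sym R≡L) L∈))
    R∈ : R ∈ labels (s ∷ r)
    R∈ = subst (_∈ labels (s ∷ r)) (ends-in-R v) (∈-map⁺ lab (last-∈ s r))

  firstMissing : ∀ {fs s r} → Valid fs (s ∷ r) → ∃ λ L → FirstMissing L fs (labels (s ∷ r))
  firstMissing {fs} {s} {r} v with firstMissing? fs (labels (s ∷ r))
  ... | inj₁ found = found
  ... | inj₂ fs⊆ = contradiction fs⊆ (some-missing v)

  decode-∷ : ∀ {fs s r L} acc → FirstMissing L fs (labels (s ∷ r)) →
    decode fs (s ∷ r) acc ≡ decode (remove L fs) r ((att L , s) ∷ acc)
  decode-∷ {fs} {s} {r} {L} acc first with firstMissing? fs (labels (s ∷ r))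
  ... | inj₂ fs⊆ = contradiction (All.lookup fs⊆ (firstMissing-∈ first)) (firstMissing-∉ first)
  ... | inj₁ (L′ , first′) with L′ ≟ L
  ...   | yes refl = refl
  ...   | no L′≢L =
          ⊥-elim ([ firstMissing-∉ first′ , firstMissing-∉ first ]′ (firstMissing-≢ first′ first L′≢L))

  ∉labels⇒≢ : ∀ {L code y} → L ∉ labels code → y ∈ code → lab y ≢ L
  ∉labels⇒≢ L∉ y∈ ly≡L = L∉ (subst (_∈ _) ly≡L (∈-map⁺ lab y∈))

  unattached-remove⁻ : ∀ {L fs x} → Unattached (remove L fs) x → Unattached fs x
  unattached-remove⁻ {fs = fs} (inj₁ lx∈) = inj₁ (proj₁ (∈-remove⁻ fs lx∈))
  unattached-remove⁻ (inj₂ lx≡R) = inj₂ lx≡R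

  unattached-remove⁺ : ∀ {L fs x} → Unattached fs x → lab x ≢ L → Unattached (remove L fs) x
  unattached-remove⁺ (inj₁ lx∈) lx≢L = inj₁ (∈-remove⁺ lx∈ lx≢L)
  unattached-remove⁺ (inj₂ lx≡R) _ = inj₂ lx≡R

  head-≢ : ∀ {L fs s r} → FirstMissing L fs (labels (s ∷ r)) → lab s ≢ L
  head-≢ first = ∉labels⇒≢ (firstMissing-∉ first) (here refl)

  module _ {fs code} (v : Valid fs code) where

    lab-att∈ : ∀ {L} → L ∈ fs → lab (att L) ≡ L
    lab-att∈ L∈ = lab-att _ (All.lookup (fs-roots v) L∈)

    att-unattached : ∀ {L} → L ∈ fs → Unattached fs (att L)
    att-unattached L∈ = inj₁ (subst (_∈ fs) (sym (lab-att∈ L∈)) L∈)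

    ∈fs⇒≢R : ∀ {L} → L ∈ fs → L ≢ R
    ∈fs⇒≢R L∈ refl = R∉fs v L∈

    removed-attached : ∀ {L x} → L ∈ fs → lab x ≡ L → ¬ Unattached (remove L fs) x
    removed-attached {L} L∈ refl (inj₁ L∈′) = proj₂ (∈-remove⁻ fs L∈′) refl
    removed-attached L∈ refl (inj₂ L≡R) = ∈fs⇒≢R L∈ L≡R

  valid-step : ∀ {fs s r L} → Valid fs (s ∷ r) → FirstMissing L fs (labels (s ∷ r)) → Valid (remove L fs) r
  valid-step {fs} {s} {r} v first = record
    { fs-unique = remove-unique (fs-unique v)
    ; fs-roots = All.tabulate (λ x∈ → All.lookup (fs-roots v) (proj₁ (∈-remove⁻ fs x∈)))
    ; R∉fs = λ R∈ → R∉fs v (proj₁ (∈-remove⁻ fs R∈))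
    ; length≡ = suc-injective (trans (length-remove (fs-unique v) (firstMissing-∈ first)) (length≡ v))
    ; code-unattached = All.tabulate (λ y∈ →
        unattached-remove⁺ (All.lookup (code-unattached v) (there y∈))
          (∉labels⇒≢ (firstMissing-∉ first) (there y∈)))
    ; ends-in-R = ends-in-R-tail r (ends-in-R v)
    }
    where
    ends-in-R-tail : ∀ r → EndsInR (s ∷ r) → EndsInR r
    ends-in-R-tail [] _ = tt
    ends-in-R-tail (_ ∷ _) e = e

  ∈-decode⁻ : ∀ fs code acc {q} → q ∈ decode fs code acc →
    q ∈ acc ⊎ ∃ λ L → L ∈ fs × proj₁ q ≡ att L × proj₂ q ∈ code
  ∈-decode⁻ fs [] acc q∈ = inj₁ q∈
  ∈-decode⁻ fs (s ∷ r) acc q∈ with firstMissing? fs (labels (s ∷ r))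
  ... | inj₂ _ = inj₁ q∈
  ... | inj₁ (L , first) with ∈-decode⁻ (remove L fs) r ((att L , s) ∷ acc) q∈
  ...   | inj₁ (here refl) = inj₂ (L , firstMissing-∈ first , refl , here refl)
  ...   | inj₁ (there q∈acc) = inj₁ q∈acc
  ...   | inj₂ (L′ , L′∈ , eq , y∈) = inj₂ (L′ , proj₁ (∈-remove⁻ fs L′∈) , eq , there y∈)

  acc⊆decode : ∀ fs code acc {q} → q ∈ acc → q ∈ decode fs code acc
  acc⊆decode fs [] acc q∈ = q∈
  acc⊆decode fs (s ∷ r) acc q∈ with firstMissing? fs (labels (s ∷ r))
  ... | inj₂ _ = q∈
  ... | inj₁ (L , _) = acc⊆decode (remove L fs) r ((att L , s) ∷ acc) (there q∈)

  -- Each new pair joins att L and s, whose κ-values L and lab s differ, hence two components of F +ᴾ acc.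
  record Separated (fs : List (Fin n)) (acc : List (Fin n × Fin n)) : Set where
    field
      κ : Fin n → Fin n
      walk⇒κ : ∀ {a b} → Walk (F +ᴾ acc) a b → κ a ≡ κ b
      κ-unattached : ∀ {x} → Unattached fs x → κ x ≡ lab x

  separated-[] : ∀ {fs} → Separated fs []
  separated-[] = record { κ = lab ; walk⇒κ = walk-invariant adj⇒lab ; κ-unattached = λ _ → refl }
    where
    adj⇒lab : ∀ {a b} → Adj (F +ᴾ []) a b → lab a ≡ lab b
    adj⇒lab adj with adj-+ᴾ⁻ {G = F} [] adj
    ... | inj₁ adjF = adj-lab adjF
    ... | inj₂ (_ , () , _)

  module Attach {fs s r L acc} (v : Valid fs (s ∷ r)) (first : FirstMissing L fs (labels (s ∷ r)))
    (sep : Separated fs acc) where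

    open Separated sep

    L∈ : L ∈ fs
    L∈ = firstMissing-∈ first

    ls≢L : lab s ≢ L
    ls≢L = head-≢ first

    κ-att : κ (att L) ≡ L
    κ-att = trans (κ-unattached (att-unattached v L∈)) (lab-att∈ v L∈)

    κ-s : κ s ≡ lab s
    κ-s = κ-unattached (All.lookup (code-unattached v) (here refl))

    κ′ : Fin n → Fin n
    κ′ x = if does (κ x ≟ L) then lab s else κ x

    κ′-outside : ∀ {x} → κ x ≢ L → κ′ x ≡ κ x
    κ′-outside {x} κx≢L with κ x ≟ L
    ... | yes κx≡L = contradiction κx≡L κx≢L
    ... | no _ = refl

    κ′-att : κ′ (att L) ≡ lab s
    κ′-att rewrite κ-att with L ≟ L
    ... | yes _ = refl
    ... | no L≢L = contradiction refl L≢L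

    κ′-s : κ′ s ≡ lab s
    κ′-s = trans (κ′-outside (λ κs≡L → ls≢L (trans (sym κ-s) κs≡L))) κ-s

    adj⇒κ′ : ∀ {a b} → Adj (F +ᴾ ((att L , s) ∷ acc)) a b → κ′ a ≡ κ′ b
    adj⇒κ′ adj with adj-+ᴾ-∷⁻ {G = F} (att L , s) acc adj
    ... | inj₁ adjH = cong (λ z → if does (z ≟ L) then lab s else z) (walk⇒κ (adjH ◅ ε))
    ... | inj₂ (inj₁ (refl , refl)) = trans κ′-att (sym κ′-s)
    ... | inj₂ (inj₂ (refl , refl)) = trans κ′-s (sym κ′-att)

    separated : Separated (remove L fs) ((att L , s) ∷ acc)
    separated = record
      { κ = κ′
      ; walk⇒κ = walk-invariant adj⇒κ′
      ; κ-unattached = κ′-unattached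
      }
      where
      κ′-unattached : ∀ {x} → Unattached (remove L fs) x → κ′ x ≡ lab x
      κ′-unattached u = trans (κ′-outside (λ κx≡L → removed-attached v L∈ (trans (sym κx≡lx) κx≡L) u)) κx≡lx
        where κx≡lx = κ-unattached (unattached-remove⁻ u)

    forest : IsForest (F +ᴾ acc) → IsForest (F +ᴾ ((att L , s) ∷ acc))
    forest = AddEdge.isForest (adj-+ᴾ-∷⁻ {G = F} (att L , s) acc)
      (λ w → ls≢L (trans (sym κ-s) (trans (sym (walk⇒κ w)) κ-att)))

  decode-forest : ∀ {fs code acc} → Valid fs code → Separated fs acc → IsForest (F +ᴾ acc) →
    IsForest (F +ᴾ decode fs code acc)
  decode-forest {code = []} _ _ forest = forest
  decode-forest {code = s ∷ r} {acc} v sep forest with firstMissing v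
  ... | L , first rewrite decode-∷ acc first =
    decode-forest (valid-step v first) (Attach.separated v first sep) (Attach.forest v first sep forest)

  valid-[]-empty : ∀ {fs L} → Valid fs [] → L ∉ fs
  valid-[]-empty {[]} _ ()
  valid-[]-empty {_ ∷ _} v _ with length≡ v
  ... | ()

  walk-to-R : ∀ {ps x} → lab x ≡ R → Walk (F +ᴾ ps) x R
  walk-to-R {ps} {x} lx≡R = walk-mono (⊆-+ᴾ ps) (subst (Walk F x) lx≡R (walk-lab x))

  decode-reaches-R : ∀ {fs code acc x} → Valid fs code → Unattached fs x → Walk (F +ᴾ decode fs code acc) x R
  decode-reaches-R {fs} {code} {acc} _ (inj₂ lx≡R) = walk-to-R {decode fs code acc} lx≡R
  decode-reaches-R {code = []} v (inj₁ lx∈) = contradiction lx∈ (valid-[]-empty v)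
  decode-reaches-R {fs} {s ∷ r} {acc} {x} v (inj₁ lx∈) with firstMissing v
  ... | L , first rewrite decode-∷ acc first with lab x ≟ L
  ...   | no lx≢L = decode-reaches-R (valid-step v first) (unattached-remove⁺ (inj₁ lx∈) lx≢L)
  ...   | yes lx≡L = walk-mono (⊆-+ᴾ out) (lab⇒walk (trans lx≡L (sym (lab-att∈ v L∈))))
                     ◅◅ att-s ◅ decode-reaches-R (valid-step v first) s-unattached
    where
    L∈ = firstMissing-∈ first
    out = decode (remove L fs) r ((att L , s) ∷ acc)
    s-unattached : Unattached (remove L fs) s
    s-unattached = unattached-remove⁺ (All.lookup (code-unattached v) (here refl)) (head-≢ first)
    att-s : Adj (F +ᴾ out) (att L) s
    att-s = adj-+ᴾ⁺ {G = F} out (acc⊆decode (remove L fs) r _ (here refl)) (inj₁ (refl , refl))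
      (λ att≡s → head-≢ first (trans (cong lab (sym att≡s)) (lab-att∈ v L∈)))

  decode-attached : ∀ {fs code acc L} → Valid fs code → L ∈ fs →
    ∃ λ y → (att L , y) ∈ decode fs code acc × lab y ≢ L × Unattached fs y
  decode-attached {code = []} v L∈ = contradiction L∈ (valid-[]-empty v)
  decode-attached {fs} {s ∷ r} {acc} {L} v L∈ with firstMissing v
  ... | L₀ , first rewrite decode-∷ acc first with L ≟ L₀
  ...   | yes refl = s , acc⊆decode (remove L fs) r _ (here refl) ,
                     head-≢ first , All.lookup (code-unattached v) (here refl)
  ...   | no L≢L₀ = let (y , y∈ , ly≢L , u) = decode-attached (valid-step v first) (∈-remove⁺ L∈ L≢L₀)
                    in y , y∈ , ly≢L , unattached-remove⁻ u

  Touches : Fin n → Fin n × Fin n → Set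
  Touches L (a , b) = lab a ≡ L ⊎ lab b ≡ L

  touches-joins : ∀ {L q a b} → Joins q a b → Touches L (a , b) → Touches L q
  touches-joins (inj₁ (refl , refl)) t = t
  touches-joins (inj₂ (refl , refl)) (inj₁ la≡L) = inj₂ la≡L
  touches-joins (inj₂ (refl , refl)) (inj₂ lb≡L) = inj₁ lb≡L

  LeafAt : Fin n → Fin n → List (Fin n × Fin n) → List (Fin n × Fin n) → Set
  LeafAt L y₀ out acc = ∀ {q} → q ∈ out → Touches L q → q ∈ acc ⊎ q ≡ (att L , y₀)

  leaf-first : ∀ {fs s r L acc} → Valid fs (s ∷ r) → FirstMissing L fs (labels (s ∷ r)) →
    LeafAt L s (decode (remove L fs) r ((att L , s) ∷ acc)) acc
  leaf-first {fs} {s} {r} {L} {acc} v first {a , b} q∈ touches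
    with ∈-decode⁻ (remove L fs) r ((att L , s) ∷ acc) q∈ | touches
  ... | inj₁ (here refl) | _ = inj₂ refl
  ... | inj₁ (there q∈acc) | _ = inj₁ q∈acc
  ... | inj₂ (L′ , L′∈ , refl , _) | inj₁ la≡L =
        contradiction (trans (sym (lab-att∈ v (proj₁ (∈-remove⁻ fs L′∈)))) la≡L) (proj₂ (∈-remove⁻ fs L′∈))
  ... | inj₂ (_ , _ , _ , b∈) | inj₂ lb≡L = contradiction lb≡L (∉labels⇒≢ (firstMissing-∉ first) (there b∈))

  decode-leaf : ∀ {fs code acc L} → Valid fs code → L ∈ fs → L ∉ labels code →
    ∃ λ y₀ → LeafAt L y₀ (decode fs code acc) acc
  decode-leaf {code = []} v L∈ _ = contradiction L∈ (valid-[]-empty v)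
  decode-leaf {code = s ∷ r} {acc} {L} v L∈ L∉ with firstMissing v
  ... | L₀ , first rewrite decode-∷ acc first with L ≟ L₀
  ...   | yes refl = s , leaf-first v first
  ...   | no L≢L₀ = let (y₀ , leaf) = decode-leaf (valid-step v first) (∈-remove⁺ L∈ L≢L₀) (L∉ ∘ there)
                    in y₀ , λ q∈ touches → past-step (leaf q∈ touches) touches
    where
    past-step : ∀ {q} → q ∈ (att L₀ , s) ∷ acc ⊎ q ≡ (att L , _) → Touches L q → q ∈ acc ⊎ q ≡ (att L , _)
    past-step (inj₁ (here refl)) (inj₁ la≡L) =
      contradiction (trans (sym la≡L) (lab-att∈ v (firstMissing-∈ first))) L≢L₀
    past-step (inj₁ (here refl)) (inj₂ ls≡L) = contradiction ls≡L (∉labels⇒≢ L∉ (here refl))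
    past-step (inj₁ (there q∈)) _ = inj₁ q∈
    past-step (inj₂ eq) _ = inj₂ eq

  Exit : List (Fin n) → Fin n → Fin n × Fin n → Set
  Exit fs L (a , b) = lab a ≢ lab b × Touches L (a , b) × Unattached fs a × Unattached fs b

  exit-remove⁻ : ∀ {L₀ fs L p} → Exit (remove L₀ fs) L p → Exit fs L p
  exit-remove⁻ (la≢lb , touches , ua , ub) = la≢lb , touches , unattached-remove⁻ ua , unattached-remove⁻ ub

  Attached : List (Fin n) → List (Fin n × Fin n) → Set
  Attached fs acc = All (λ q → ¬ Unattached fs (proj₁ q)) acc

  leaf-no-exit : ∀ {fs acc out L y₀ a b} → Attached fs acc → LeafAt L y₀ out acc → Exit fs L (a , b) →
    ¬ Joins (att L , y₀) a b → ¬ Adj (F +ᴾ out) a b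
  leaf-no-exit {out = out} attached leaf (la≢lb , touches , ua , ub) ¬j adj with adj-+ᴾ⁻ {G = F} out adj
  ... | inj₁ adjF = la≢lb (adj-lab adjF)
  ... | inj₂ (q , q∈ , j) with leaf q∈ (touches-joins j touches)
  ...   | inj₂ refl = ¬j j
  ...   | inj₁ q∈acc with joins-end j
  ...     | inj₁ refl = All.lookup attached q∈acc ua
  ...     | inj₂ refl = All.lookup attached q∈acc ub

  exit-differ : ∀ {fs acc out out′ L y₀ p} → Attached fs acc → LeafAt L y₀ out acc → p ∈ out′ → Exit fs L p →
    ¬ Joins (att L , y₀) (proj₁ p) (proj₂ p) → Differ (F +ᴾ out′) (F +ᴾ out)
  exit-differ {out′ = out′} attached leaf p∈ exit@(la≢lb , _) ¬j =
    differ-adj (adj-+ᴾ⁺ {G = F} out′ p∈ joins-self (la≢lb ∘ cong lab)) (leaf-no-exit attached leaf exit ¬j)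

  TwoExits : List (Fin n) → Fin n → List (Fin n × Fin n) → Set
  TwoExits fs L out = ∃₂ λ p p′ → p ∈ out × p′ ∈ out ×
    Exit fs L p × Exit fs L p′ × ¬ Joins p (proj₁ p′) (proj₂ p′)

  branch-head : ∀ {fs s r L₀ L acc} → Valid fs (s ∷ r) → FirstMissing L₀ fs (labels (s ∷ r)) →
    L ∈ fs → lab s ≡ L →
    TwoExits fs L (decode (remove L₀ fs) r ((att L₀ , s) ∷ acc))
  branch-head {fs} {s} {r} {L₀} {L} {acc} v first L∈ ls≡L
    with decode-attached {acc = (att L₀ , s) ∷ acc} (valid-step v first)
           (∈-remove⁺ L∈ (λ L≡L₀ → head-≢ first (trans ls≡L L≡L₀)))
  ... | y , att-y∈ , ly≢L , uy =
    (att L₀ , s) , (att L , y) , acc⊆decode (remove L₀ fs) r _ (here refl) , att-y∈ , exit₀ , exit , distinct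
    where
    L₀∈ = firstMissing-∈ first
    exit₀ : Exit fs L (att L₀ , s)
    exit₀ = (λ la≡ls → head-≢ first (trans (sym la≡ls) (lab-att∈ v L₀∈))) , inj₂ ls≡L ,
            att-unattached v L₀∈ , All.lookup (code-unattached v) (here refl)
    exit : Exit fs L (att L , y)
    exit = (λ la≡ly → ly≢L (trans (sym la≡ly) (lab-att∈ v L∈))) , inj₁ (lab-att∈ v L∈) ,
           att-unattached v L∈ , unattached-remove⁻ uy
    distinct : ¬ Joins (att L₀ , s) (att L) y
    distinct (inj₁ (att≡att , _)) =
      head-≢ first (trans ls≡L (trans (sym (lab-att∈ v L∈)) (trans (cong lab att≡att) (lab-att∈ v L₀∈))))
    distinct (inj₂ (_ , y≡att)) = removed-attached v L₀∈ (trans (cong lab y≡att) (lab-att∈ v L₀∈)) uy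

  decode-branch : ∀ {fs code acc L} → Valid fs code → L ∈ fs → L ∈ labels code →
    TwoExits fs L (decode fs code acc)
  decode-branch {code = []} _ _ ()
  decode-branch {code = s ∷ r} {acc} v L∈ L∈labels with firstMissing v
  ... | L₀ , first rewrite decode-∷ acc first with L∈labels
  ...   | here L≡ls = branch-head v first L∈ (sym L≡ls)
  ...   | there L∈labels′
          with decode-branch (valid-step v first)
                 (∈-remove⁺ L∈ (λ { refl → firstMissing-∉ first (there L∈labels′) })) L∈labels′
  ...     | p , p′ , p∈ , p′∈ , exit , exit′ , distinct =
            p , p′ , p∈ , p′∈ , exit-remove⁻ exit , exit-remove⁻ exit′ , distinct

  leaf-vs-branch : ∀ {fs code code′ acc L} → Valid fs code → Valid fs code′ → Attached fs acc →
    L ∈ fs → L ∉ labels code → L ∈ labels code′ → Differ (F +ᴾ decode fs code′ acc) (F +ᴾ decode fs code acc)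
  leaf-vs-branch {acc = acc} {L} v v′ attached L∈ L∉ L∈′
    with decode-leaf {acc = acc} v L∈ L∉ | decode-branch {acc = acc} v′ L∈ L∈′
  ... | y₀ , leaf | (a , b) , p′ , p∈ , p′∈ , exit , exit′ , distinct with joins? (att L , y₀) a b
  ...   | no ¬j = exit-differ attached leaf p∈ exit ¬j
  ...   | yes j = exit-differ attached leaf p′∈ exit′ (distinct ∘ joins-trans j)

  first-letter-differ : ∀ {fs s s′ r r′ L acc} → Valid fs (s ∷ r) → Valid fs (s′ ∷ r′) → Attached fs acc →
    FirstMissing L fs (labels (s ∷ r)) → FirstMissing L fs (labels (s′ ∷ r′)) → s ≢ s′ →
    Differ (F +ᴾ decode (remove L fs) r ((att L , s) ∷ acc))
           (F +ᴾ decode (remove L fs) r′ ((att L , s′) ∷ acc))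
  first-letter-differ {fs} {s} {s′} {r} {L = L} v v′ attached first first′ s≢s′ =
    exit-differ attached (leaf-first v′ first′) (acc⊆decode (remove L fs) r _ (here refl)) exit ¬joins
    where
    L∈ = firstMissing-∈ first
    exit : Exit fs L (att L , s)
    exit = (λ la≡ls → head-≢ first (trans (sym la≡ls) (lab-att∈ v L∈))) , inj₁ (lab-att∈ v L∈) ,
           att-unattached v L∈ , All.lookup (code-unattached v) (here refl)
    ¬joins : ¬ Joins (att L , s′) (att L) s
    ¬joins (inj₁ (_ , s≡s′)) = s≢s′ s≡s′
    ¬joins (inj₂ (_ , s≡att)) = head-≢ first (trans (cong lab s≡att) (lab-att∈ v L∈))

  attached-step : ∀ {fs code L s acc} → Valid fs code → L ∈ fs → Attached fs acc →
    Attached (remove L fs) ((att L , s) ∷ acc)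
  attached-step v L∈ attached =
    removed-attached v L∈ (lab-att∈ v L∈) ∷ All.map (λ ¬u u → ¬u (unattached-remove⁻ u)) attached

  decode-injective : ∀ {fs code code′ acc} → Valid fs code → Valid fs code′ → Attached fs acc → code ≢ code′ →
    Differ (F +ᴾ decode fs code acc) (F +ᴾ decode fs code′ acc)
  decode-injective {code = []} {[]} _ _ _ []≢[] = contradiction refl []≢[]
  decode-injective {code = []} {_ ∷ _} v v′ _ _ with trans (sym (length≡ v)) (length≡ v′)
  ... | ()
  decode-injective {code = _ ∷ _} {[]} v v′ _ _ with trans (sym (length≡ v)) (length≡ v′)
  ... | ()
  decode-injective {code = s ∷ r} {s′ ∷ r′} {acc} v v′ attached code≢code′
    with firstMissing v | firstMissing v′
  ... | L , first | L′ , first′ with L ≟ L′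
  ...   | no L≢L′ =
          [ (λ L∈′ → differ-sym (leaf-vs-branch v v′ attached (firstMissing-∈ first) (firstMissing-∉ first) L∈′))
          , (λ L′∈ → leaf-vs-branch v′ v attached (firstMissing-∈ first′) (firstMissing-∉ first′) L′∈)
          ]′ (firstMissing-≢ first first′ L≢L′)
  ...   | yes refl rewrite decode-∷ acc first | decode-∷ acc first′ with s ≟ s′
  ...     | no s≢s′ = first-letter-differ v v′ attached first first′ s≢s′
  ...     | yes refl = decode-injective (valid-step v first) (valid-step v′ first′)
                         (attached-step v (firstMissing-∈ first) attached) (code≢code′ ∘ cong (s ∷_))

  decode-spanningTree : ∀ {fs code} → IsForest F → (∀ x → Unattached fs x) → Valid fs code →
    IsSpanningTree (F +ᴾ decode fs code [])
  decode-spanningTree F-forest unattached v =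
    (λ a b → decode-reaches-R v (unattached a) ◅◅ walk-sym (decode-reaches-R v (unattached b))) ,
    decode-forest v separated-[] (forest-antimono +ᴾ-[] F-forest)

-- The family of trees

module _ {n : ℕ} where

  ⊈ᴳ⇒witness : ∀ {G H : Graph n} → ¬ G ⊆ᴳ H → ∃ λ e → G e ≡ true × H e ≡ false
  ⊈ᴳ⇒witness {G} {H} G⊈H with Any.any? (λ e → (G e Bool.≟ true) ×-dec (H e Bool.≟ false)) (allEdges n)
  ... | yes found = let (e , _ , Ge , He) = find found in e , Ge , He
  ... | no none = contradiction G⊆H G⊈H
    where
    G⊆H : G ⊆ᴳ H
    G⊆H e Ge with H e in He
    ... | true = refl
    ... | false = contradiction (lose (∈-allEdges e) (Ge , He)) none

  star-∌ : ∀ {c} {e : Edge n} → star c e ≡ false → Edge.lo e ≢ c × Edge.hi e ≢ c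
  star-∌ {c} {edge a b _} ∌ with a ≟ c | b ≟ c
  star-∌ () | yes _ | _
  star-∌ () | no _ | yes _
  ... | no a≢c | no b≢c = a≢c , b≢c

  star-∋ : ∀ {c} {e : Edge n} → star c e ≡ true → Edge.lo e ≡ c ⊎ Edge.hi e ≡ c
  star-∋ {c} {edge a b _} ∋ with a ≟ c | b ≟ c
  ... | yes a≡c | _ = inj₁ a≡c
  ... | no _ | yes b≡c = inj₂ b≡c

  neighbour? : (F : Graph n) (c : Fin n) → (∃ λ w → Adj F c w) ⊎ (∀ w → ¬ Adj F c w)
  neighbour? F c with Any.any? (adj? F c) (allFin n)
  ... | yes found = let (w , _ , cw) = find found in inj₁ (w , cw)
  ... | no none = inj₂ (λ w cw → none (lose (∈-allFin w) cw))

  isolated-walk : ∀ {F : Graph n} {c x} → (∀ w → ¬ Adj F c w) → Walk F c x → x ≡ c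
  isolated-walk isolated ε = refl
  isolated-walk isolated (cw ◅ _) = contradiction cw (isolated _)

∸-bound : ∀ n t m → n ≤ suc (suc m) + t → n ∸ 2 ∸ t ≤ m
∸-bound n t m n≤ = ≤-trans (∸-monoˡ-≤ t (∸-monoˡ-≤ 2 n≤)) (≤-reflexive (m+n∸n≡m m t))

power-bound : ∀ a {e m} → 1 ≤ a → e ≤ m → a ^ e < a ^ m * 2
power-bound (suc a) {m = m} _ e≤m =
  ≤-<-trans (^-monoʳ-≤ (suc a) e≤m) (m<m*n (suc a ^ m) 2 {{m^n≢0 (suc a) m}} (s≤s (s≤s z≤n)))

module PrüferFamily {n : ℕ} {F : Graph n} (F-forest : IsForest F) (c : Fin n)
  (e : Edge n) (Fe : F e ≡ true) (e∉S : star c e ≡ false) (w₀ : Fin n) (c~w₀ : Walk F c w₀) where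

  open Components (components F)
  open DecLists (_≟_ {n})

  u v : Fin n
  u = Edge.lo e
  v = Edge.hi e

  uv : Adj F u v
  uv = inj₁ (Edge.lo<hi e , Fe)

  u≢c : u ≢ c
  u≢c = proj₁ (star-∌ {e = e} e∉S)

  v≢c : v ≢ c
  v≢c = proj₂ (star-∌ {e = e} e∉S)

  R : Fin n
  R = lab u

  -- The component of c is attached through w₀; taking for w₀ an F-neighbour of c keeps c off every new edge.
  att : Fin n → Fin n
  att L = if does (L ≟ c) then w₀ else L

  lab-att : ∀ L → lab L ≡ L → lab (att L) ≡ L
  lab-att L lL≡L with L ≟ c
  ... | yes refl = trans (sym (walk⇒lab c~w₀)) lL≡L
  ... | no _ = lL≡L

  open Decoding (components F) R att lab-att public

  fs₀ : List (Fin n)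
  fs₀ = remove R (roots lab)

  alphabet : List (Fin n)
  alphabet = remove c (allFin n)

  codes : ℕ → List (List (Fin n))
  codes zero = []
  codes (suc m) = cartesianProductWith _∷ʳ_ (words alphabet m) (u ∷ v ∷ [])

  tree : List (Fin n) → Graph n
  tree code = F +ᴾ decode fs₀ code []

  trees : List (Graph n)
  trees = map tree (codes (length fs₀))

  all-unattached : ∀ x → Unattached fs₀ x
  all-unattached x with lab x ≟ R
  ... | yes lx≡R = inj₂ lx≡R
  ... | no lx≢R = inj₁ (∈-remove⁺ (∈-roots⁺ lab (lab-idem x)) lx≢R)

  ∈-codes⁻ : ∀ k {code} → code ∈ codes k →
    ∃₂ λ w z → code ≡ w ∷ʳ z × suc (length w) ≡ k × All (_∈ alphabet) w × z ∈ u ∷ v ∷ []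
  ∈-codes⁻ (suc m) code∈ with ∈-cartesianProductWith⁻ _∷ʳ_ (words alphabet m) (u ∷ v ∷ []) code∈
  ... | w , z , w∈ , z∈ , refl =
    w , z , refl , cong suc (proj₁ (∈-words⁻ m w∈)) , proj₂ (∈-words⁻ m w∈) , z∈

  letter-≢c : ∀ {k code s} → code ∈ codes k → s ∈ code → s ≢ c
  letter-≢c {k} code∈ s∈ with ∈-codes⁻ k code∈
  ... | w , z , refl , _ , w⊆ , z∈ with ∈-++⁻ w s∈ | z∈
  ...   | inj₁ s∈w | _ = proj₂ (∈-remove⁻ (allFin n) (All.lookup w⊆ s∈w))
  ...   | inj₂ (here refl) | here refl = u≢c
  ...   | inj₂ (here refl) | there (here refl) = v≢c

  valid : ∀ {code} → code ∈ codes (length fs₀) → Valid fs₀ code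
  valid code∈ with ∈-codes⁻ (length fs₀) code∈
  ... | w , z , refl , length≡ , _ , z∈ = record
    { fs-unique = remove-unique (roots-unique lab)
    ; fs-roots = All.tabulate (λ x∈ → ∈-roots⁻ lab (proj₁ (∈-remove⁻ (roots lab) x∈)))
    ; R∉fs = λ R∈ → proj₂ (∈-remove⁻ (roots lab) R∈) refl
    ; length≡ = trans (sym length≡) (sym (trans (length-++ w) (+-comm (length w) 1)))
    ; code-unattached = All.tabulate (λ {x} _ → all-unattached x)
    ; ends-in-R = ends-in-R w (lab-z z∈)
    }
    where
    lab-z : ∀ {z} → z ∈ u ∷ v ∷ [] → lab z ≡ R
    lab-z (here refl) = refl
    lab-z (there (here refl)) = sym (adj-lab uv)
    ends-in-R : ∀ w → lab z ≡ R → EndsInR (w ∷ʳ z)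
    ends-in-R [] lz≡R = lz≡R
    ends-in-R (a ∷ w) lz≡R = trans (cong lab (last-∷ʳ a w z)) lz≡R

  codes-unique : ∀ k → Unique (codes k)
  codes-unique zero = []
  codes-unique (suc m) = Unique.cartesianProductWith⁺ _∷ʳ_ (∷ʳ-injective _ _)
    (words-unique m (remove-unique (allFin⁺ n))) ((adj⇒≢ {G = F} uv ∷ []) ∷ [] ∷ [])

  length-codes : ∀ m → length (codes (suc m)) ≡ (n ∸ 1) ^ m * 2
  length-codes m = begin
    length (codes (suc m))            ≡⟨ length-cartesianProductWith _∷ʳ_ (words alphabet m) (u ∷ v ∷ []) ⟩
    length (words alphabet m) * 2     ≡⟨ cong (_* 2) (length-words alphabet m) ⟩
    length alphabet ^ m * 2           ≡⟨ cong (λ a → a ^ m * 2) length-alphabet ⟩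
    (n ∸ 1) ^ m * 2                   ∎
    where
    open ≡-Reasoning
    length-alphabet : length alphabet ≡ n ∸ 1
    length-alphabet = cong (_∸ 1) (trans (length-remove (allFin⁺ n) (∈-allFin c)) (length-tabulate {n = n} id))

  n≤fs₀+edges : n ≤ suc (length fs₀) + edgeCount F
  n≤fs₀+edges = subst (λ k → n ≤ k + edgeCount F)
    (sym (length-remove (roots-unique lab) (∈-roots⁺ lab (lab-idem u))))
    n≤roots+edges

  many-codes : ∀ t k → t + 3 ≤ n → n ≤ suc k + t → (n ∸ 1) ^ (n ∸ 2 ∸ t) < length (codes k)
  many-codes t zero t+3≤n n≤ = contradiction (≤-trans t+3≤n n≤) (¬t+3≤1+t t)
    where
    ¬t+3≤1+t : ∀ t → ¬ (t + 3 ≤ suc t)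
    ¬t+3≤1+t zero (s≤s ())
    ¬t+3≤1+t (suc t) (s≤s le) = ¬t+3≤1+t t le
  many-codes t (suc m) t+3≤n n≤ rewrite length-codes m =
    power-bound (n ∸ 1) (≤-trans (s≤s z≤n) (∸-monoˡ-≤ 1 (≤-trans (m≤n+m 3 t) t+3≤n))) (∸-bound n t m n≤)

  trees-distinct : AllPairs Differ trees
  trees-distinct = allPairs-map (codes-unique (length fs₀))
    (λ code∈ code′∈ code≢code′ → decode-injective (valid code∈) (valid code′∈) [] code≢code′)

  Result : ℕ → Set
  Result t = ∃ λ (Ts : List (Graph n)) → AllPairs Differ Ts ×
    All (λ T → IsSpanningTree T × F ⊆ᴳ T × edgeCount (T ∩ᴳ star c) < t) Ts ×
    (n ∸ 1) ^ (n ∸ 2 ∸ t) < length Ts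

  result : ∀ t → t + 3 ≤ n → edgeCount F ≡ t →
    (∀ {code} → code ∈ codes (length fs₀) → edgeCount (tree code ∩ᴳ star c) < t) → Result t
  result t t+3≤n |F|≡t few-star-edges =
    trees , trees-distinct ,
    All.map⁺ (All.tabulate (λ {code} code∈ →
      decode-spanningTree F-forest all-unattached (valid code∈) , ⊆-+ᴾ (decode fs₀ code []) ,
      few-star-edges code∈)) ,
    subst ((n ∸ 1) ^ (n ∸ 2 ∸ t) <_) (sym (length-map tree (codes (length fs₀))))
      (many-codes t (length fs₀) t+3≤n (subst (λ t → n ≤ suc (length fs₀) + t) |F|≡t n≤fs₀+edges))

  module ViaNeighbour (c∼w₀ : Adj F c w₀) where

    att-≢c : ∀ L → att L ≢ c
    att-≢c L with L ≟ c
    ... | yes _ = ≢-sym (adj⇒≢ {G = F} c∼w₀)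
    ... | no L≢c = L≢c

    tree∩S⊆F∩S : ∀ {code} → code ∈ codes (length fs₀) → (tree code ∩ᴳ star c) ⊆ᴳ (F ∩ᴳ star c)
    tree∩S⊆F∩S {code} code∈ e′ in-both with ∩ᴳ⁻ {G = tree code} {H = star c} in-both
    ... | in-tree , in-S with edge-+ᴾ⁻ {G = F} (decode fs₀ code []) e′ in-tree
    ...   | inj₁ Fe′ rewrite Fe′ = in-S
    ...   | inj₂ (q , q∈ , j) with ∈-decode⁻ fs₀ code [] q∈
    ...     | inj₁ ()
    ...     | inj₂ (L , _ , refl , s∈) =
              ⊥-elim ([ proj₁ ends-≢c , proj₂ ends-≢c ]′ (star-∋ {e = e′} in-S))
      where
      ends-≢c = joins-∉ (att-≢c L) (letter-≢c {length fs₀} code∈ s∈) j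

    few-star-edges : ∀ {code} → code ∈ codes (length fs₀) → edgeCount (tree code ∩ᴳ star c) < edgeCount F
    few-star-edges code∈ = ≤-<-trans (edgeCount-mono (tree∩S⊆F∩S code∈))
      (edgeCount-< (λ _ in-both → proj₁ (∩ᴳ⁻ {G = F} {H = star c} in-both)) e
        (trans (cong (_∧ star c e) Fe) e∉S) Fe)

  module ViaIsolation (isolated : ∀ w → ¬ Adj F c w) where

    lab-c : lab c ≡ c
    lab-c = isolated-walk isolated (walk-lab c)

    lab≡c : ∀ {x} → lab x ≡ c → x ≡ c
    lab≡c {x} lx≡c = isolated-walk isolated (subst (λ z → Walk F z x) lx≡c (walk-sym (walk-lab x)))

    c∈fs₀ : c ∈ fs₀
    c∈fs₀ = ∈-remove⁺ (∈-roots⁺ lab lab-c) (λ c≡R → u≢c (lab≡c (sym c≡R)))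

    c∉labels : ∀ {code} → code ∈ codes (length fs₀) → c ∉ labels code
    c∉labels code∈ c∈ =
      let (s , s∈ , c≡ls) = ∈-map⁻ lab c∈ in letter-≢c {length fs₀} code∈ s∈ (lab≡c (sym c≡ls))

    touches-c : ∀ {a b} → a ≡ c ⊎ b ≡ c → Touches c (a , b)
    touches-c = Sum.map (λ { refl → lab-c }) (λ { refl → lab-c })

    att-c : att c ≡ c
    att-c with c ≟ c
    ... | yes _ = isolated-walk isolated c~w₀
    ... | no c≢c = contradiction refl c≢c

    star-edges-joins : ∀ {code} → code ∈ codes (length fs₀) →
      ∃ λ y₀ → ∀ e′ → (tree code ∩ᴳ star c) e′ ≡ true → Joins (c , y₀) (Edge.lo e′) (Edge.hi e′)
    star-edges-joins {code} code∈ with decode-leaf {acc = []} (valid code∈) c∈fs₀ (c∉labels code∈)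
    ... | y₀ , leaf = y₀ , joins
      where
      joins : ∀ e′ → (tree code ∩ᴳ star c) e′ ≡ true → Joins (c , y₀) (Edge.lo e′) (Edge.hi e′)
      joins e′@(edge a b p) in-both with ∩ᴳ⁻ {G = tree code} {H = star c} in-both
      ... | in-tree , in-S with edge-+ᴾ⁻ {G = F} (decode fs₀ code []) e′ in-tree | star-∋ {e = e′} in-S
      ...   | inj₁ Fe′ | inj₁ refl = contradiction (inj₁ (p , Fe′)) (isolated b)
      ...   | inj₁ Fe′ | inj₂ refl = contradiction (inj₂ (p , Fe′)) (isolated a)
      ...   | inj₂ (q , q∈ , j) | a≡c⊎b≡c with leaf q∈ (touches-joins j (touches-c a≡c⊎b≡c))
      ...     | inj₂ refl = subst (λ x → Joins (x , y₀) a b) att-c j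

    few-star-edges : ∀ {code} → code ∈ codes (length fs₀) → edgeCount (tree code ∩ᴳ star c) ≤ 1
    few-star-edges code∈ = let (y₀ , joins) = star-edges-joins code∈ in edgeCount≤1 (c , y₀) joins

lemma13 : (n t : ℕ) → 1 < t → t + 3 ≤ n →
    (F : Graph n) → IsForest F → edgeCount F ≡ t →
    (c : Fin n) → ¬ (F ⊆ᴳ star c) →
    ∃ λ (Ts : List (Graph n)) →
      AllPairs Differ Ts ×
      All (λ T → IsSpanningTree T × F ⊆ᴳ T × edgeCount (T ∩ᴳ star c) < t) Ts ×
      (n ∸ 1) ^ (n ∸ 2 ∸ t) < length Ts
lemma13 n t 1<t t+3≤n F F-forest |F|≡t c F⊈S with ⊈ᴳ⇒witness F⊈S | neighbour? F c
... | e , Fe , e∉S | inj₁ (w , c∼w) =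
  result t t+3≤n |F|≡t (λ code∈ → subst (_ <_) |F|≡t (ViaNeighbour.few-star-edges c∼w code∈))
  where open PrüferFamily F-forest c e Fe e∉S w (c∼w ◅ ε)
... | e , Fe , e∉S | inj₂ isolated =
  result t t+3≤n |F|≡t (λ code∈ → ≤-<-trans (ViaIsolation.few-star-edges isolated code∈) 1<t)
  where open PrüferFamily F-forest c e Fe e∉S c ε
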